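{- Let $m\ge 3$ be an odd integer with $m\not\equiv 0\pmod 3$. Then the rose window graph $R_{2m}(m-2,m-1)$ is not a Cayley graph.
   Context: For integers $n\ge 3$ and $1\le a,r\le n-1$, the rose window graph $R_n(a,r)$ has vertex set $\{A_i,B_i : i\in\mathbb{Z}_n\}$ and edges $A_iA_{i+1}$, $A_iB_i$, $A_{i+a}B_i$ and $B_iB_{i+r}$, indices taken modulo $n$. A graph is Cayley iff its automorphism group has a subgroup acting regularly on its vertices. -}

module Defs where

open import Data.Nat using (ℕ; _+_; _*_)
open import Data.Fin using (Fin; toℕ)
open import Data.Product using (Σ; ∃; _×_; _,_)
open import Data.Sum using (_⊎_)
open import Relation.Binary.PropositionalEquality using (_≡_)
open import Function using (_∘_; id)
open import Function.Definitions using (Bijective)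
open import Function.Bundles using (_⇔_)

_≡_[mod_] : ℕ → ℕ → ℕ → Set
x ≡ y [mod n ] = (∃ λ k → x + k * n ≡ y) ⊎ (∃ λ k → y + k * n ≡ x)

data Side : Set where
  A B : Side

-- Vertex (A , i) is A_i and (B , i) is B_i, for i ∈ ℤ_n (represented by Fin n).
RWVertex : ℕ → Set
RWVertex n = Side × Fin n

-- Adjacency of the rose window graph R_n(a, r): edges A_iA_{i+1}, A_iB_i,
-- A_{i+a}B_i, B_iB_{i+r} (indices mod n), as a symmetric relation.
RWAdj : (n a r : ℕ) → RWVertex n → RWVertex n → Set
RWAdj n a r (A , i) (A , j) =
  (toℕ j ≡ toℕ i + 1 [mod n ]) ⊎ (toℕ i ≡ toℕ j + 1 [mod n ])
RWAdj n a r (A , i) (B , j) =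
  (toℕ i ≡ toℕ j [mod n ]) ⊎ (toℕ i ≡ toℕ j + a [mod n ])
RWAdj n a r (B , i) (A , j) =
  (toℕ j ≡ toℕ i [mod n ]) ⊎ (toℕ j ≡ toℕ i + a [mod n ])
RWAdj n a r (B , i) (B , j) =
  (toℕ j ≡ toℕ i + r [mod n ]) ⊎ (toℕ i ≡ toℕ j + r [mod n ])

IsAutomorphism : {V : Set} → (V → V → Set) → (V → V) → Set
IsAutomorphism {V} Adj f =
  Bijective {A = V} _≡_ _≡_ f × (∀ u v → Adj u v ⇔ Adj (f u) (f v))

-- H (a predicate on maps V → V) is a subgroup of Aut(Γ) acting regularly on V.
-- Automorphisms are compared pointwise.
IsRegularAutSubgroup : {V : Set} → (V → V → Set) → ((V → V) → Set) → Set
IsRegularAutSubgroup {V} Adj H =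
  (∀ f → H f → IsAutomorphism Adj f)
  × H id
  × (∀ f g → H f → H g → H (g ∘ f))
  × (∀ f → H f → Σ (V → V) λ g → H g × (∀ v → g (f v) ≡ v) × (∀ v → f (g v) ≡ v))
  × (∀ u v → Σ (V → V) λ f → H f × f u ≡ v)
  × (∀ f g u → H f → H g → f u ≡ g u → ∀ w → f w ≡ g w)

-- A graph is Cayley iff Aut(Γ) has a subgroup acting regularly on the vertices.
IsCayley : {V : Set} → (V → V → Set) → Set₁
IsCayley {V} Adj = Σ ((V → V) → Set) λ H → IsRegularAutSubgroup Adj H

RoseWindowCayley : (n a r : ℕ) → Set₁
RoseWindowCayley n a r = IsCayley (RWAdj n a r)

-- Through ℤ₂ₘ ≅ ℤₘ × ℤ₂ (m odd) the rose window graph R₂ₘ(m − 2, m − 1) is the underlying graph of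
-- the line digraph of the directed m-cycle with doubled vertices: its vertices are the arcs
-- (b, s) → (b + 1, t), two arcs being adjacent when one ends where the other starts.
-- Two distinct vertices with two common neighbours differ in exactly one end colour (m ≠ 4 rules
-- out directed 4-cycles), so every automorphism either preserves or swaps the two colour flips,
-- and then, up to the reversal b ↦ −1 − b, it is a rotation b ↦ b + c combined with colour flips
-- s ↦ s ⊕ w(b), t ↦ t ⊕ w(b + 1).
-- In a regular group of automorphisms some element rotates by a unit c. Conjugating a nontrivial
-- pure flip w by it, two of the first five conjugates agree at one vertex and hence everywhere, so w
-- has period d·c with d ≤ 4; as 2 and 3 are units mod m, w is constant, i.e. it flips every colour.
-- The element sending the origin to its tail twin contradicts this: if it preserves the flips it is
-- a pure flip leaving a head colour unchanged, and if it swaps them its square is a pure flip whose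
-- two contributions cancel at the fixed point of b ↦ −1 − b.

module Submission where

open import Data.Bool using (Bool; true; false; not; _xor_; _∧_)
open import Data.Bool.Properties
  using ( ∧-zeroʳ; ∧-identityʳ; not-involutive; not-injective; not-¬; ¬-not
        ; not-distribˡ-xor; xor-same; xor-identityʳ; xor-comm; true-xor )
  renaming (_≟_ to _≟ᵇ_)
open import Data.Empty using (⊥; ⊥-elim)
open import Data.Fin using (Fin; toℕ; fromℕ<; zero; suc)
import Data.Fin.Properties as Fin
open import Data.Nat using (ℕ; zero; suc; _+_; _*_; _∸_; _≤_; _<_; z≤n; s≤s)
open import Data.Nat.Properties
open import Data.Nat.DivMod
open import Data.Nat.Divisibility using (_∣_; divides)
open import Data.Nat.Tactic.RingSolver using (solve-∀)
open import Data.Product using (∃-syntax; _×_; _,_; proj₁; proj₂)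
open import Data.Sum using (_⊎_; inj₁; inj₂; swap)
open import Data.Sum.Function.Propositional using (_⊎-⇔_)
open import Function using (_∘_)
open import Function.Bundles using (Equivalence; _⇔_; mk⇔)
open import Relation.Binary.PropositionalEquality hiding ([_])
open import Relation.Nullary using (¬_; yes; no)
open import Relation.Binary.Bundles using (Setoid)
import Relation.Binary.Reasoning.Setoid as SetoidReasoning
open import Level using (0ℓ)
open import Defs

true≢false : true ≢ false
true≢false ()

xor-cancelˡ : ∀ a {x y} → a xor x ≡ a xor y → x ≡ y
xor-cancelˡ false e = e
xor-cancelˡ true  e = not-injective e

odd : ℕ → Bool
odd zero    = false
odd (suc n) = not (odd n)

odd-+ : ∀ a b → odd (a + b) ≡ odd a xor odd b
odd-+ zero    b = refl
odd-+ (suc a) b rewrite odd-+ a b = not-distribˡ-xor (odd a) (odd b)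

odd-* : ∀ a b → odd (a * b) ≡ odd a ∧ odd b
odd-* zero    b = refl
odd-* (suc a) b rewrite odd-+ b (a * b) | odd-* a b with odd a | odd b
... | true  | true  = refl
... | true  | false = refl
... | false | true  = refl
... | false | false = refl

odd≡false⇒double : ∀ x → odd x ≡ false → ∃[ h ] x ≡ h + h
odd≡false⇒double zero          _ = 0 , refl
odd≡false⇒double (suc (suc x)) e with odd≡false⇒double x (trans (sym (not-involutive (odd x))) e)
... | h , x≡h+h = suc h , cong suc (trans (cong suc x≡h+h) (sym (+-suc h h)))

2∤⇒odd : ∀ m → ¬ 2 ∣ m → odd m ≡ true
2∤⇒odd m 2∤m with odd m in parity
... | true  = refl
... | false with h , m≡h+h ← odd≡false⇒double m parity = ⊥-elim (2∤m (divides h (trans m≡h+h (h+h≡h*2 h))))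
  where
    h+h≡h*2 : ∀ h → h + h ≡ h * 2
    h+h≡h*2 = solve-∀

module Modular (k : ℕ) where

  m : ℕ
  m = suc k

  infix 4 _≈_
  record _≈_ (a b : ℕ) : Set where
    constructor mk≈
    field %-≡ : a % m ≡ b % m

  ≈-refl : ∀ {a} → a ≈ a
  ≈-refl = mk≈ refl

  ≈-sym : ∀ {a b} → a ≈ b → b ≈ a
  ≈-sym (mk≈ p) = mk≈ (sym p)

  ≈-trans : ∀ {a b c} → a ≈ b → b ≈ c → a ≈ c
  ≈-trans (mk≈ p) (mk≈ q) = mk≈ (trans p q)

  ≡⇒≈ : ∀ {a b} → a ≡ b → a ≈ b
  ≡⇒≈ refl = ≈-refl

  +-cong-≈ : ∀ {a b c d} → a ≈ b → c ≈ d → a + c ≈ b + d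
  +-cong-≈ {a} {b} {c} {d} (mk≈ p) (mk≈ q) = mk≈ (begin
    (a + c) % m           ≡⟨ %-distribˡ-+ a c m ⟩
    (a % m + c % m) % m   ≡⟨ cong₂ (λ x y → (x + y) % m) p q ⟩
    (b % m + d % m) % m   ≡⟨ %-distribˡ-+ b d m ⟨
    (b + d) % m           ∎)
    where open ≡-Reasoning

  *-cong-≈ : ∀ {a b c d} → a ≈ b → c ≈ d → a * c ≈ b * d
  *-cong-≈ {a} {b} {c} {d} (mk≈ p) (mk≈ q) = mk≈ (begin
    (a * c) % m             ≡⟨ %-distribˡ-* a c m ⟩
    (a % m * (c % m)) % m   ≡⟨ cong₂ (λ x y → (x * y) % m) p q ⟩
    (b % m * (d % m)) % m   ≡⟨ %-distribˡ-* b d m ⟨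
    (b * d) % m             ∎)
    where open ≡-Reasoning

  +-*m-≈ : ∀ a q → a + q * m ≈ a
  +-*m-≈ a q = mk≈ ([m+kn]%n≡m%n a q m)

  ≈-by : ∀ {a b} p q → a + p * m ≡ b + q * m → a ≈ b
  ≈-by {a} {b} p q e = ≈-trans (≈-sym (+-*m-≈ a p)) (≈-trans (≡⇒≈ e) (+-*m-≈ b q))

  ≈-setoid : Setoid 0ℓ 0ℓ
  ≈-setoid = record { Carrier = ℕ ; _≈_ = _≈_
                    ; isEquivalence = record { refl = ≈-refl ; sym = ≈-sym ; trans = ≈-trans } }

  module ≈-Reasoning = SetoidReasoning ≈-setoid

  +-cancelʳ-≈ : ∀ {a b} c → a + c ≈ b + c → a ≈ b
  +-cancelʳ-≈ {a} {b} c e = begin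
    a                 ≈⟨ +-*m-≈ a c ⟨
    a + c * m         ≡⟨ +-*m-split a ⟩
    a + c + c * k     ≈⟨ +-cong-≈ e ≈-refl ⟩
    b + c + c * k     ≡⟨ +-*m-split b ⟨
    b + c * m         ≈⟨ +-*m-≈ b c ⟩
    b                 ∎
    where
      open ≈-Reasoning
      +-*m-split : ∀ x → x + c * m ≡ x + c + c * k
      +-*m-split x = split x c k
        where split : ∀ x c k → x + c * suc k ≡ x + c + c * k
              split = solve-∀

  ≈⇒difference-≤ : ∀ {a b} → a ≈ b → a / m ≤ b / m → ∃[ q ] a + q * m ≡ b
  ≈⇒difference-≤ {a} {b} (mk≈ e) le with d , a/m+d≡b/m ← m≤n⇒∃[o]m+o≡n le = d , (begin
    a + d * m                     ≡⟨ cong (_+ d * m) (m≡m%n+[m/n]*n a m) ⟩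
    a % m + a / m * m + d * m     ≡⟨ +-assoc (a % m) _ _ ⟩
    a % m + (a / m * m + d * m)   ≡⟨ cong (a % m +_) (*-distribʳ-+ m (a / m) d) ⟨
    a % m + (a / m + d) * m       ≡⟨ cong₂ (λ x y → x + y * m) e a/m+d≡b/m ⟩
    b % m + b / m * m             ≡⟨ m≡m%n+[m/n]*n b m ⟨
    b                             ∎)
    where open ≡-Reasoning

  ≈⇒difference : ∀ {a b} → a ≈ b → (∃[ q ] a + q * m ≡ b) ⊎ (∃[ q ] b + q * m ≡ a)
  ≈⇒difference {a} {b} a≈b with ≤-total (a / m) (b / m)
  ... | inj₁ le = inj₁ (≈⇒difference-≤ a≈b le)
  ... | inj₂ le = inj₂ (≈⇒difference-≤ (≈-sym a≈b) le)

  Unit : ℕ → Set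
  Unit c = ∃[ u ] c * u ≈ 1

  *-unit : ∀ {a b} → Unit a → Unit b → Unit (a * b)
  *-unit {a} {b} (u , au≈1) (v , bv≈1) =
    u * v , ≈-trans (≡⇒≈ (rearrange a b u v)) (*-cong-≈ au≈1 bv≈1)
    where rearrange : ∀ a b u v → (a * b) * (u * v) ≡ (a * u) * (b * v)
          rearrange = solve-∀

  ≈-unit : ∀ {a b} → a ≈ b → Unit b → Unit a
  ≈-unit a≈b (u , bu≈1) = u , ≈-trans (*-cong-≈ a≈b ≈-refl) bu≈1

  unit-3 : ¬ 3 ∣ m → Unit 3
  unit-3 3∤m = from-remainder (m % 3) (m%n<n m 3) (m≡m%n+[m/n]*n m 3)
    where
      q : ℕ
      q = m / 3
      from-remainder : ∀ r → r < 3 → m ≡ r + q * 3 → Unit 3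
      from-remainder 0 _ e = ⊥-elim (3∤m (divides q e))
      from-remainder 1 _ e = 2 * q + 1 , ≈-by 0 2 (trans (+-identityʳ _) (trans (expand q) (cong (λ m → 1 + 2 * m) (sym e))))
        where expand : ∀ q → 3 * (2 * q + 1) ≡ 1 + 2 * (1 + q * 3)
              expand = solve-∀
      from-remainder 2 _ e = q + 1 , ≈-by 0 1 (trans (+-identityʳ _) (trans (expand q) (cong (λ m → 1 + 1 * m) (sym e))))
        where expand : ∀ q → 3 * (q + 1) ≡ 1 + 1 * (2 + q * 3)
              expand = solve-∀
      from-remainder (suc (suc (suc _))) (s≤s (s≤s (s≤s ()))) _

  Z : Set
  Z = Fin m

  [_] : ℕ → Z
  [ x ] = fromℕ< (m%n<n x m)

  toℕ-[] : ∀ x → toℕ [ x ] ≡ x % m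
  toℕ-[] x = Fin.toℕ-fromℕ< (m%n<n x m)

  toℕ-[]-≈ : ∀ x → toℕ [ x ] ≈ x
  toℕ-[]-≈ x = mk≈ (trans (cong (_% m) (toℕ-[] x)) (m%n%n≡m%n x m))

  []-toℕ : ∀ b → [ toℕ b ] ≡ b
  []-toℕ b = Fin.toℕ-injective (trans (toℕ-[] (toℕ b)) (m<n⇒m%n≡m (Fin.toℕ<n b)))

  []-cong : ∀ {a b} → a ≈ b → [ a ] ≡ [ b ]
  []-cong {a} {b} (mk≈ e) = Fin.toℕ-injective (trans (toℕ-[] a) (trans e (sym (toℕ-[] b))))

  []-injective : ∀ {a b} → [ a ] ≡ [ b ] → a ≈ b
  []-injective {a} {b} e = mk≈ (trans (sym (toℕ-[] a)) (trans (cong toℕ e) (toℕ-[] b)))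

  toℕ-≈-injective : ∀ {b c : Z} → toℕ b ≈ toℕ c → b ≡ c
  toℕ-≈-injective {b} {c} e = trans (sym ([]-toℕ b)) (trans ([]-cong e) ([]-toℕ c))

  shift : ℕ → Z → Z
  shift c b = [ toℕ b + c ]

  next : Z → Z
  next = shift 1

  prev : Z → Z
  prev = shift k

  -- b ↦ −1 − b
  mirror : Z → Z
  mirror b = [ k + k * toℕ b ]

  shift-shift : ∀ c d b → shift c (shift d b) ≡ shift (d + c) b
  shift-shift c d b =
    []-cong (≈-trans (+-cong-≈ (toℕ-[]-≈ (toℕ b + d)) ≈-refl) (≡⇒≈ (+-assoc (toℕ b) d c)))

  shift-cong : ∀ {c d} b → c ≈ d → shift c b ≡ shift d b
  shift-cong b e = []-cong (+-cong-≈ (≈-refl {toℕ b}) e)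

  shift-0 : ∀ b → shift 0 b ≡ b
  shift-0 b = trans (cong [_] (+-identityʳ (toℕ b))) ([]-toℕ b)

  shift-comm : ∀ c d b → shift c (shift d b) ≡ shift d (shift c b)
  shift-comm c d b =
    trans (shift-shift c d b) (trans (cong (λ e → shift e b) (+-comm d c)) (sym (shift-shift d c b)))

  shift-injective : ∀ c {b b'} → shift c b ≡ shift c b' → b ≡ b'
  shift-injective c e = toℕ-≈-injective (+-cancelʳ-≈ c ([]-injective e))

  next-injective : ∀ {b b'} → next b ≡ next b' → b ≡ b'
  next-injective = shift-injective 1

  shift-≈ : ∀ {c d} b → shift c b ≡ shift d b → c ≈ d
  shift-≈ {c} {d} b e = +-cancelʳ-≈ (toℕ b)
    (≈-trans (≡⇒≈ (+-comm c (toℕ b))) (≈-trans ([]-injective e) (≡⇒≈ (+-comm (toℕ b) d))))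

  next-prev : ∀ b → next (prev b) ≡ b
  next-prev b = trans (shift-shift 1 k b) (trans (shift-cong b (≈-by 0 1 (k+1≡m k))) (shift-0 b))
    where k+1≡m : ∀ k → k + 1 + 0 * suc k ≡ 0 + 1 * suc k
          k+1≡m = solve-∀

  shift-from : ∀ (z b : Z) → shift (toℕ b + k * toℕ z) z ≡ b
  shift-from z b = trans ([]-cong (≈-by 0 (toℕ z) (reassociate (toℕ z) (toℕ b) k))) ([]-toℕ b)
    where reassociate : ∀ z b k → z + (b + k * z) + 0 * suc k ≡ b + z * suc k
          reassociate = solve-∀

  next-induction : (P : Z → Set) (z : Z) → P z → (∀ b → P b → P (next b)) → ∀ b → P b
  next-induction P z Pz step b = subst P (shift-from z b) (along _)
    where
      along : ∀ n → P (shift n z)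
      along zero    = subst P (sym (shift-0 z)) Pz
      along (suc n) = subst P (trans (shift-shift 1 n z) (cong (λ e → shift e z) (+-comm n 1)))
                             (step _ (along n))

  next⁴≡shift4 : ∀ b → next (next (next (next b))) ≡ shift 4 b
  next⁴≡shift4 b = trans (cong next (trans (cong next (shift-shift 1 1 b)) (shift-shift 1 2 b))) (shift-shift 1 3 b)

  next-mirror-next : ∀ b → next (mirror (next b)) ≡ mirror b
  next-mirror-next b = toℕ-≈-injective (begin
    toℕ [ toℕ (mirror (next b)) + 1 ]   ≈⟨ toℕ-[]-≈ _ ⟩
    toℕ (mirror (next b)) + 1           ≈⟨ +-cong-≈ (toℕ-[]-≈ (k + k * toℕ (next b))) (≈-refl {1}) ⟩
    k + k * toℕ (next b) + 1            ≈⟨ +-cong-≈ (+-cong-≈ (≈-refl {k}) (*-cong-≈ (≈-refl {k}) (toℕ-[]-≈ _))) (≈-refl {1}) ⟩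
    k + k * (toℕ b + 1) + 1             ≈⟨ ≈-by 0 1 (expand k (toℕ b)) ⟩
    k + k * toℕ b                       ≈⟨ toℕ-[]-≈ _ ⟨
    toℕ (mirror b)                      ∎)
    where
      open ≈-Reasoning
      expand : ∀ k b → k + k * (b + 1) + 1 + 0 * suc k ≡ k + k * b + 1 * suc k
      expand = solve-∀

  mirror-involutive : ∀ b → mirror (mirror b) ≡ b
  mirror-involutive b = toℕ-≈-injective (begin
    toℕ (mirror (mirror b))          ≈⟨ toℕ-[]-≈ _ ⟩
    k + k * toℕ (mirror b)           ≈⟨ +-cong-≈ (≈-refl {k}) (*-cong-≈ (≈-refl {k}) (toℕ-[]-≈ _)) ⟩
    k + k * (k + k * toℕ b)          ≈⟨ ≈-by (toℕ b) (k + toℕ b * k) (expand k (toℕ b)) ⟩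
    toℕ b                            ∎)
    where
      open ≈-Reasoning
      expand : ∀ k b → k + k * (k + k * b) + b * suc k ≡ b + (k + b * k) * suc k
      expand = solve-∀

  next-mirror-zero : next (mirror zero) ≡ zero
  next-mirror-zero = toℕ-≈-injective (begin
    toℕ [ toℕ (mirror zero) + 1 ]   ≈⟨ toℕ-[]-≈ _ ⟩
    toℕ (mirror zero) + 1           ≈⟨ +-cong-≈ (toℕ-[]-≈ (k + k * 0)) ≈-refl ⟩
    k + k * 0 + 1                   ≈⟨ ≈-by 0 1 (expand k) ⟩
    0                               ∎)
    where
      open ≈-Reasoning
      expand : ∀ k → k + k * 0 + 1 + 0 * suc k ≡ 0 + 1 * suc k
      expand = solve-∀

  Periodic : (Z → Bool) → ℕ → Set
  Periodic w e = ∀ b → w (shift e b) ≡ w b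

  periodic-* : ∀ {w e} → Periodic w e → ∀ n → Periodic w (n * e)
  periodic-* {w} per zero    b = cong w (shift-0 b)
  periodic-* {w} {e} per (suc n) b =
    trans (cong w (trans (cong (λ d → shift d b) (+-comm e (n * e))) (sym (shift-shift e (n * e) b))))
          (trans (per _) (periodic-* per n b))

  periodic-unit : ∀ {w e} → Periodic w e → Unit e → Periodic w 1
  periodic-unit {w} {e} per (u , eu≈1) b =
    trans (cong w (shift-cong b (≈-sym (≈-trans (≡⇒≈ (*-comm u e)) eu≈1)))) (periodic-* per u b)

  periodic-1⇒constant : ∀ {w} → Periodic w 1 → ∀ b → w b ≡ w zero
  periodic-1⇒constant {w} per = next-induction (λ b → w b ≡ w zero) zero refl (λ b e → trans (per b) e)

  repeat⇒periodic : ∀ {c} {w wᵢ wⱼ : Z → Bool} i d →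
                    (∀ b → wᵢ (shift (i * c) b) ≡ w b) → (∀ b → wⱼ (shift ((i + d) * c) b) ≡ w b) →
                    (∀ b → wᵢ b ≡ wⱼ b) → Periodic w (d * c)
  repeat⇒periodic {c} {w} {wᵢ} {wⱼ} i d wᵢ-shift wⱼ-shift wᵢ≡wⱼ b = begin
    w (shift (d * c) b)                  ≡⟨ wᵢ-shift (shift (d * c) b) ⟨
    wᵢ (shift (i * c) (shift (d * c) b)) ≡⟨ wᵢ≡wⱼ (shift (i * c) (shift (d * c) b)) ⟩
    wⱼ (shift (i * c) (shift (d * c) b)) ≡⟨ cong wⱼ (trans (shift-shift (i * c) (d * c) b) (cong (λ e → shift e b) (sym [i+d]c))) ⟩
    wⱼ (shift ((i + d) * c) b)           ≡⟨ wⱼ-shift b ⟩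
    w b                                  ∎
    where
      open ≡-Reasoning
      [i+d]c : (i + d) * c ≡ d * c + i * c
      [i+d]c = trans (*-distribʳ-+ c i d) (+-comm (i * c) (d * c))

  odd-*2m : ∀ q → odd (q * (2 * m)) ≡ false
  odd-*2m q = trans (odd-* q (2 * m)) (trans (cong (odd q ∧_) (odd-* 2 m)) (∧-zeroʳ (odd q)))

  ≡[mod2m]⇒ : ∀ {x y} → x ≡ y [mod (2 * m) ] → x ≈ y × odd x ≡ odd y
  ≡[mod2m]⇒ (inj₁ (q , e)) = from-difference {q = q} e
    where
      from-difference : ∀ {x y q} → x + q * (2 * m) ≡ y → x ≈ y × odd x ≡ odd y
      from-difference {x} {y} {q} e = ≈-by (q * 2) 0 (trans (cong (x +_) (*-assoc q 2 m)) (trans e (sym (+-identityʳ y)))) ,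
        (begin
          odd x                          ≡⟨ xor-identityʳ (odd x) ⟨
          odd x xor false                ≡⟨ cong (odd x xor_) (odd-*2m q) ⟨
          odd x xor odd (q * (2 * m))    ≡⟨ odd-+ x (q * (2 * m)) ⟨
          odd (x + q * (2 * m))          ≡⟨ cong odd e ⟩
          odd y                          ∎)
        where open ≡-Reasoning
  ≡[mod2m]⇒ (inj₂ (q , e)) with y≈x , py≡px ← ≡[mod2m]⇒ {_} {_} (inj₁ (q , e)) = ≈-sym y≈x , sym py≡px

  module OddModulus (odd-m : odd m ≡ true) where

    half-k : ∃[ h ] k ≡ h + h
    half-k = odd≡false⇒double k (trans (sym (not-involutive (odd k))) (cong not odd-m))

    h : ℕ
    h = proj₁ half-k

    k≡h+h : k ≡ h + h
    k≡h+h = proj₂ half-k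

    unit-2 : Unit 2
    unit-2 = suc h , ≈-by 0 1 (subst (λ k → 2 * suc h + 0 * suc k ≡ 1 + 1 * suc k) (sym k≡h+h) (expand h))
      where expand : ∀ h → 2 * suc h + 0 * suc (h + h) ≡ 1 + 1 * suc (h + h)
            expand = solve-∀

    mirror-fixed : mirror [ h ] ≡ [ h ]
    mirror-fixed = toℕ-≈-injective (begin
      toℕ (mirror [ h ])       ≈⟨ toℕ-[]-≈ _ ⟩
      k + k * toℕ [ h ]        ≈⟨ +-cong-≈ (≈-refl {k}) (*-cong-≈ (≈-refl {k}) (toℕ-[]-≈ h)) ⟩
      k + k * h                ≈⟨ ≈-by 0 h (subst (λ k → k + k * h + 0 * suc k ≡ h + h * suc k) (sym k≡h+h) (expand h)) ⟩
      h                        ≈⟨ toℕ-[]-≈ h ⟨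
      toℕ [ h ]                ∎)
      where
        open ≈-Reasoning
        expand : ∀ h → h + h + (h + h) * h + 0 * suc (h + h) ≡ h + h * suc (h + h)
        expand = solve-∀

    unit-≤4 : Unit 3 → ∀ d → 1 ≤ d → d ≤ 4 → Unit d
    unit-≤4 _      1 _ _ = 1 , ≈-refl
    unit-≤4 _      2 _ _ = unit-2
    unit-≤4 unit₃  3 _ _ = unit₃
    unit-≤4 _      4 _ _ = *-unit {2} {2} unit-2 unit-2
    unit-≤4 _      (suc (suc (suc (suc (suc _))))) _ (s≤s (s≤s (s≤s (s≤s ()))))

    odd-+-*m : ∀ x q → odd (x + q * m) ≡ odd x xor odd q
    odd-+-*m x q = trans (odd-+ x (q * m)) (cong (odd x xor_) (trans (odd-* q m) (trans (cong (odd q ∧_) odd-m) (∧-identityʳ (odd q)))))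

    even-quotient : ∀ {x y q} → x + q * m ≡ y → odd x ≡ odd y → odd q ≡ false
    even-quotient {x} {y} {q} e px≡py = xor-cancelˡ (odd x) (begin
      odd x xor odd q    ≡⟨ odd-+-*m x q ⟨
      odd (x + q * m)    ≡⟨ cong odd e ⟩
      odd y              ≡⟨ px≡py ⟨
      odd x              ≡⟨ xor-identityʳ (odd x) ⟨
      odd x xor false    ∎)
      where open ≡-Reasoning

    halve : ∀ {x y q} → x + q * m ≡ y → odd x ≡ odd y → ∃[ h ] x + h * (2 * m) ≡ y
    halve {x} {y} {q} e px≡py with h , q≡h+h ← odd≡false⇒double q (even-quotient {q = q} e px≡py) =
      h , trans (cong (x +_) (h*2m≡[h+h]*m h m)) (trans (cong (λ q → x + q * m) (sym q≡h+h)) e)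
      where
        h*2m≡[h+h]*m : ∀ h m → h * (2 * m) ≡ (h + h) * m
        h*2m≡[h+h]*m = solve-∀

    ≡[mod2m]⇐ : ∀ {x y} → x ≈ y → odd x ≡ odd y → x ≡ y [mod (2 * m) ]
    ≡[mod2m]⇐ x≈y px≡py with ≈⇒difference x≈y
    ... | inj₁ (q , e) = inj₁ (halve {q = q} e px≡py)
    ... | inj₂ (q , e) = inj₂ (halve {q = q} e (sym px≡py))

module ArcGraph (k : ℕ) where
  open Modular k

  -- arc b s t is the arc (b, s) → (b + 1, t).
  record Arc : Set where
    constructor arc
    field
      base : Z
      tail : Bool
      head : Bool
  open Arc public

  arc-≡ : ∀ {b b' s s' t t'} → b ≡ b' → s ≡ s' → t ≡ t' → arc b s t ≡ arc b' s' t'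
  arc-≡ refl refl refl = refl

  infix 4 _⇝_
  record _⇝_ (x y : Arc) : Set where
    constructor link
    field
      next-base : next (base x) ≡ base y
      head≡tail : head x ≡ tail y

  Adjacent : Arc → Arc → Set
  Adjacent x y = x ⇝ y ⊎ y ⇝ x

  Mono : (Arc → Arc) → Set
  Mono F = (∀ {x y} → F x ≡ F y → x ≡ y) × (∀ {x y} → Adjacent x y → Adjacent (F x) (F y))

  origin : Arc
  origin = arc zero false false

  record RegularGroup : Set₁ where
    field
      Member         : (Arc → Arc) → Set
      member-ext     : ∀ {f g} → Member f → (∀ x → f x ≡ g x) → Member g
      member-mono    : ∀ {f} → Member f → Mono f
      member-∘       : ∀ {f g} → Member f → Member g → Member (g ∘ f)
      member-inverse : ∀ {f} → Member f → ∃[ g ] Member g × (∀ x → g (f x) ≡ x) × (∀ x → f (g x) ≡ x)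
      transitive     : ∀ y → ∃[ f ] Member f × f origin ≡ y
      semiregular    : ∀ {f g} x → Member f → Member g → f x ≡ g x → ∀ z → f z ≡ g z

  module _ {W : Set} {Adj : W → W → Set} {φ : W → Arc} {ψ : Arc → W}
           (φψ : ∀ x → φ (ψ x) ≡ x) (ψφ : ∀ u → ψ (φ u) ≡ u)
           (adjacent⇔ : ∀ u v → Adj u v ⇔ Adjacent (φ u) (φ v)) where

    private
      φ-injective : ∀ {u v} → φ u ≡ φ v → u ≡ v
      φ-injective {u} {v} e = trans (sym (ψφ u)) (trans (cong ψ e) (ψφ v))

    cayley⇒regularGroup : IsCayley Adj → RegularGroup
    cayley⇒regularGroup (H , H-aut , _ , H-∘ , H-inverse , H-transitive , H-semiregular) = record
      { Member         = Member
      ; member-ext     = λ { (f , f∈H , g≗) g≗g' → f , f∈H , λ x → trans (sym (g≗g' x)) (g≗ x) }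
      ; member-mono    = member-mono
      ; member-∘       = member-∘
      ; member-inverse = member-inverse
      ; transitive     = λ y → let (f , f∈H , f-ψorigin) = H-transitive (ψ origin) (ψ y) in
                                 φ ∘ f ∘ ψ , (f , f∈H , λ _ → refl) , trans (cong φ f-ψorigin) (φψ y)
      ; semiregular    = λ { x (f₁ , f₁∈H , g₁≗) (f₂ , f₂∈H , g₂≗) g₁x≡g₂x z →
                               trans (g₁≗ z) (trans (cong φ (H-semiregular f₁ f₂ (ψ x) f₁∈H f₂∈H
                                 (φ-injective (trans (sym (g₁≗ x)) (trans g₁x≡g₂x (g₂≗ x)))) (ψ z))) (sym (g₂≗ z))) }
      }
      where
        Member : (Arc → Arc) → Set
        Member g = ∃[ f ] H f × (∀ x → g x ≡ φ (f (ψ x)))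

        member-mono : ∀ {g} → Member g → Mono g
        member-mono {g} (f , f∈H , g≗) = injective , adjacent
          where
            f-aut : IsAutomorphism Adj f
            f-aut = H-aut f f∈H
            injective : ∀ {x y} → g x ≡ g y → x ≡ y
            injective {x} {y} gx≡gy = trans (sym (φψ x)) (trans (cong φ (proj₁ (proj₁ f-aut)
                                        (φ-injective (trans (sym (g≗ x)) (trans gx≡gy (g≗ y)))))) (φψ y))
            adjacent : ∀ {x y} → Adjacent x y → Adjacent (g x) (g y)
            adjacent {x} {y} x~y = subst₂ Adjacent (sym (g≗ x)) (sym (g≗ y))
              (Equivalence.to (adjacent⇔ _ _) (Equivalence.to (proj₂ f-aut (ψ x) (ψ y))
                (Equivalence.from (adjacent⇔ (ψ x) (ψ y)) (subst₂ Adjacent (sym (φψ x)) (sym (φψ y)) x~y))))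

        member-∘ : ∀ {g₁ g₂} → Member g₁ → Member g₂ → Member (g₂ ∘ g₁)
        member-∘ {g₁} (f₁ , f₁∈H , g₁≗) (f₂ , f₂∈H , g₂≗) =
          f₂ ∘ f₁ , H-∘ f₁ f₂ f₁∈H f₂∈H ,
          λ x → trans (g₂≗ (g₁ x)) (cong (φ ∘ f₂) (trans (cong ψ (g₁≗ x)) (ψφ _)))

        member-inverse : ∀ {g} → Member g → ∃[ g⁻¹ ] Member g⁻¹ × (∀ x → g⁻¹ (g x) ≡ x) × (∀ x → g (g⁻¹ x) ≡ x)
        member-inverse {g} (f , f∈H , g≗) with f⁻¹ , f⁻¹∈H , left , right ← H-inverse f f∈H =
          φ ∘ f⁻¹ ∘ ψ , (f⁻¹ , f⁻¹∈H , λ _ → refl) ,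
          (λ x → trans (cong (φ ∘ f⁻¹ ∘ ψ) (g≗ x)) (trans (cong (φ ∘ f⁻¹) (ψφ _)) (trans (cong φ (left _)) (φψ x)))) ,
          (λ x → trans (g≗ _) (trans (cong (φ ∘ f) (ψφ _)) (trans (cong φ (right _)) (φψ x))))

module ArcAutomorphisms (k : ℕ) (4≉0 : ¬ Modular._≈_ k 4 0) where
  open Modular k
  open ArcGraph k

  flipTail : Arc → Arc
  flipTail (arc b s t) = arc b (not s) t

  flipHead : Arc → Arc
  flipHead (arc b s t) = arc b s (not t)

  flipTail-≢ : ∀ x → x ≢ flipTail x
  flipTail-≢ x e = not-¬ refl (cong tail e)

  flipHead-≢ : ∀ x → x ≢ flipHead x
  flipHead-≢ x e = not-¬ refl (cong head e)

  flipTail≢flipHead : ∀ x → flipTail x ≢ flipHead x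
  flipTail≢flipHead x e = not-¬ refl (sym (cong tail e))

  Twin : Arc → Arc → Set
  Twin x y = y ≡ flipTail x ⊎ y ≡ flipHead x

  twin-≢ : ∀ {x y} → Twin x y → x ≢ y
  twin-≢ {x} (inj₁ refl) = flipTail-≢ x
  twin-≢ {x} (inj₂ refl) = flipHead-≢ x

  same-base-head⇒flipTail : ∀ {x y} → base x ≡ base y → head x ≡ head y → x ≢ y → y ≡ flipTail x
  same-base-head⇒flipTail {arc b s t} {arc b' s' t'} refl refl x≢y =
    arc-≡ refl (¬-not λ s'≡s → x≢y (cong (λ s → arc b s t) (sym s'≡s))) refl

  same-base-tail⇒flipHead : ∀ {x y} → base x ≡ base y → tail x ≡ tail y → x ≢ y → y ≡ flipHead x
  same-base-tail⇒flipHead {arc b s t} {arc b' s' t'} refl refl x≢y =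
    arc-≡ refl refl (¬-not λ t'≡t → x≢y (cong (arc b s) (sym t'≡t)))

  ⇝-same-target : ∀ {x y z} → x ⇝ z → y ⇝ z → base x ≡ base y × head x ≡ head y
  ⇝-same-target (link bx hx) (link by hy) = next-injective (trans bx (sym by)) , trans hx (sym hy)

  ⇝-same-source : ∀ {x y z} → z ⇝ x → z ⇝ y → base x ≡ base y × tail x ≡ tail y
  ⇝-same-source (link bx tx) (link by ty) = trans (sym bx) by , trans (sym tx) ty

  ⇝-path-unique : ∀ {x y z z'} → x ⇝ z → z ⇝ y → x ⇝ z' → z' ⇝ y → z ≡ z'
  ⇝-path-unique (link bz tz) (link _ hz) (link bz' tz') (link _ hz') =
    arc-≡ (trans (sym bz) bz') (trans (sym tz) tz') (trans hz (sym hz'))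

  no-⇝-4-cycle : ∀ {x y z w} → x ⇝ y → y ⇝ z → z ⇝ w → w ⇝ x → ⊥
  no-⇝-4-cycle {x} (link bxy _) (link byz _) (link bzw _) (link bwx _) =
    4≉0 (shift-≈ (base x) (trans (sym (next⁴≡shift4 (base x))) (trans round-trip (sym (shift-0 (base x))))))
    where
      round-trip : next (next (next (next (base x)))) ≡ base x
      round-trip = trans (cong next (trans (cong next (trans (cong next bxy) byz)) bzw)) bwx

  data Between (x y z : Arc) : Set where
    forward  : x ⇝ z → z ⇝ y → Between x y z
    backward : y ⇝ z → z ⇝ x → Between x y z

  common-neighbour : ∀ {x y z} → x ≢ y → Adjacent x z → Adjacent y z → Twin x y ⊎ Between x y z
  common-neighbour x≢y (inj₁ x⇝z) (inj₁ y⇝z) with bx≡by , hx≡hy ← ⇝-same-target x⇝z y⇝z =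
    inj₁ (inj₁ (same-base-head⇒flipTail bx≡by hx≡hy x≢y))
  common-neighbour x≢y (inj₁ x⇝z) (inj₂ z⇝y) = inj₂ (forward x⇝z z⇝y)
  common-neighbour x≢y (inj₂ z⇝x) (inj₁ y⇝z) = inj₂ (backward y⇝z z⇝x)
  common-neighbour x≢y (inj₂ z⇝x) (inj₂ z⇝y) with bx≡by , tx≡ty ← ⇝-same-source z⇝x z⇝y =
    inj₁ (inj₂ (same-base-tail⇒flipHead bx≡by tx≡ty x≢y))

  between-unique : ∀ {x y z z'} → Between x y z → Between x y z' → z ≡ z'
  between-unique (forward p q)  (forward p' q')  = ⇝-path-unique p q p' q'
  between-unique (backward p q) (backward p' q') = ⇝-path-unique p q p' q'
  between-unique (forward p q)  (backward p' q') = ⊥-elim (no-⇝-4-cycle p q p' q')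
  between-unique (backward p q) (forward p' q')  = ⊥-elim (no-⇝-4-cycle p' q' p q)

  record TwoCommonNeighbours (x y : Arc) : Set where
    constructor common
    field
      {z₁ z₂} : Arc
      z₁≢z₂   : z₁ ≢ z₂
      x~z₁    : Adjacent x z₁
      y~z₁    : Adjacent y z₁
      x~z₂    : Adjacent x z₂
      y~z₂    : Adjacent y z₂

  twin⇒two-common : ∀ {x y} → Twin x y → TwoCommonNeighbours x y
  twin⇒two-common {arc b s t} (inj₁ refl) =
    common {z₁ = arc (next b) t false} {z₂ = arc (next b) t true} (λ ())
      (inj₁ (link refl refl)) (inj₁ (link refl refl)) (inj₁ (link refl refl)) (inj₁ (link refl refl))
  twin⇒two-common {arc b s t} (inj₂ refl) =
    common {z₁ = arc (prev b) false s} {z₂ = arc (prev b) true s} (λ ())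
      (inj₂ (link (next-prev b) refl)) (inj₂ (link (next-prev b) refl)) (inj₂ (link (next-prev b) refl)) (inj₂ (link (next-prev b) refl))

  two-common⇒twin : ∀ {x y} → x ≢ y → TwoCommonNeighbours x y → Twin x y
  two-common⇒twin x≢y (common z₁≢z₂ x~z₁ y~z₁ x~z₂ y~z₂)
    with common-neighbour x≢y x~z₁ y~z₁ | common-neighbour x≢y x~z₂ y~z₂
  ... | inj₁ twin | _         = twin
  ... | inj₂ _    | inj₁ twin = twin
  ... | inj₂ bw₁  | inj₂ bw₂  = ⊥-elim (z₁≢z₂ (between-unique bw₁ bw₂))

  mono-∘ : ∀ {F G} → Mono F → Mono G → Mono (G ∘ F)
  mono-∘ (F-inj , F-adj) (G-inj , G-adj) = F-inj ∘ G-inj , G-adj ∘ F-adj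

  mono-twin : ∀ {F x y} → Mono F → Twin x y → Twin (F x) (F y)
  mono-twin (F-inj , F-adj) twin with common z₁≢z₂ x~z₁ y~z₁ x~z₂ y~z₂ ← twin⇒two-common twin =
    two-common⇒twin (twin-≢ twin ∘ F-inj)
      (common (z₁≢z₂ ∘ F-inj) (F-adj x~z₁) (F-adj y~z₁) (F-adj x~z₂) (F-adj y~z₂))

  Intertwines : (Arc → Arc) → (Arc → Arc) → (Arc → Arc) → Set
  Intertwines F g g' = ∀ x → F (g x) ≡ g' (F x)

  Preserving : (Arc → Arc) → Set
  Preserving F = Intertwines F flipTail flipTail × Intertwines F flipHead flipHead

  Reversing : (Arc → Arc) → Set
  Reversing F = Intertwines F flipTail flipHead × Intertwines F flipHead flipTail

  intertwines-∘ : ∀ {F G g h l} → Intertwines F g h → Intertwines G h l → Intertwines (G ∘ F) g l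
  intertwines-∘ {F} {G} F-gh G-hl x = trans (cong G (F-gh x)) (G-hl (F x))

  intertwines-inverse : ∀ {F F' g h} → Intertwines F g h → (∀ x → F' (F x) ≡ x) → (∀ x → F (F' x) ≡ x) →
                        Intertwines F' h g
  intertwines-inverse {F} {F'} {g} {h} F-gh left right x = begin
    F' (h x)             ≡⟨ cong (F' ∘ h) (right x) ⟨
    F' (h (F (F' x)))    ≡⟨ cong F' (F-gh (F' x)) ⟨
    F' (F (g (F' x)))    ≡⟨ left (g (F' x)) ⟩
    g (F' x)             ∎
    where open ≡-Reasoning

  intertwines-ext : ∀ {F F' g h} → (∀ x → F x ≡ F' x) → Intertwines F g h → Intertwines F' g h
  intertwines-ext {F} {F'} {g} {h} F≗F' F-gh x = trans (sym (F≗F' (g x))) (trans (F-gh x) (cong h (F≗F' x)))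

  conjugate-preserving : ∀ {g g⁻¹ k} → Preserving g → Preserving k →
                         (∀ x → g⁻¹ (g x) ≡ x) → (∀ x → g (g⁻¹ x) ≡ x) → Preserving (g ∘ k ∘ g⁻¹)
  conjugate-preserving {g} {g⁻¹} {k} (gT , gH) (kT , kH) left right = conj gT kT , conj gH kH
    where
      conj : ∀ {h} → Intertwines g h h → Intertwines k h h → Intertwines (g ∘ k ∘ g⁻¹) h h
      conj {h} g-h k-h = intertwines-∘ {k ∘ g⁻¹} {g} {h} {h} {h}
        (intertwines-∘ {g⁻¹} {k} {h} {h} {h} (intertwines-inverse {g} {g⁻¹} {h} {h} g-h left right) k-h) g-h

  reversing-∘ : ∀ {F G} → Reversing F → Reversing G → Preserving (G ∘ F)
  reversing-∘ {F} {G} (FT , FH) (GT , GH) =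
    intertwines-∘ {F} {G} {flipTail} {flipHead} {flipTail} FT GH , intertwines-∘ {F} {G} {flipHead} {flipTail} {flipHead} FH GT

  flipTail-⇝ : ∀ {x z} → x ⇝ z → flipTail x ⇝ z
  flipTail-⇝ (link b h) = link b h

  ⇝-flipHead : ∀ {x z} → x ⇝ z → x ⇝ flipHead z
  ⇝-flipHead (link b h) = link b h

  ⇝-from-flipTail-pair : ∀ {x y} → Adjacent x y → Adjacent (flipTail x) y → x ⇝ y
  ⇝-from-flipTail-pair (inj₁ x⇝y)           _                         = x⇝y
  ⇝-from-flipTail-pair (inj₂ _)             (inj₁ (link b h))         = link b h
  ⇝-from-flipTail-pair (inj₂ (link _ hy≡tx)) (inj₂ (link _ hy≡¬tx)) = ⊥-elim (not-¬ hy≡tx hy≡¬tx)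

  module _ {F : Arc → Arc} (mono : Mono F) where

    private
      F-inj : ∀ {x y} → F x ≡ F y → x ≡ y
      F-inj = proj₁ mono
      F-adj : ∀ {x y} → Adjacent x y → Adjacent (F x) (F y)
      F-adj = proj₂ mono

    flips-not-merged : ∀ x → F (flipTail x) ≢ F (flipHead x)
    flips-not-merged x = flipTail≢flipHead x ∘ F-inj

    mono-⇝ : ∀ {x z} → F (flipTail x) ≡ flipTail (F x) → x ⇝ z → F x ⇝ F z
    mono-⇝ {x} {z} comm x⇝z =
      ⇝-from-flipTail-pair (F-adj (inj₁ x⇝z)) (subst (λ y → Adjacent y (F z)) comm (F-adj (inj₁ (flipTail-⇝ x⇝z))))

    flipHead-commutes-at-follower : ∀ {x z} → F (flipTail x) ≡ flipTail (F x) → x ⇝ z → F (flipHead z) ≡ flipHead (F z)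
    flipHead-commutes-at-follower {x} {z} comm x⇝z
      with base≡ , tail≡ ← ⇝-same-source (mono-⇝ comm x⇝z) (mono-⇝ comm (⇝-flipHead x⇝z)) =
      same-base-tail⇒flipHead base≡ tail≡ (flipHead-≢ z ∘ F-inj)

    flipTail-commutes-at-follower : ∀ {x z} → F (flipTail x) ≡ flipTail (F x) → x ⇝ z → F (flipTail z) ≡ flipTail (F z)
    flipTail-commutes-at-follower {x} {z} comm x⇝z with mono-twin mono (inj₁ (refl {x = flipTail z}))
    ... | inj₁ e = e
    ... | inj₂ e = ⊥-elim (flips-not-merged z (trans e (sym (flipHead-commutes-at-follower comm x⇝z))))

    flipTail-commutes-everywhere : ∀ {x₀} → F (flipTail x₀) ≡ flipTail (F x₀) → Intertwines F flipTail flipTail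
    flipTail-commutes-everywhere {arc b₀ s₀ t₀} comm₀ (arc b s t) = next-induction CommutesAt (next (next b₀)) at-b₀+2 step b s t
      where
        CommutesAt : Z → Set
        CommutesAt b = ∀ s t → F (flipTail (arc b s t)) ≡ flipTail (F (arc b s t))
        at-b₀+2 : CommutesAt (next (next b₀))
        at-b₀+2 s t = flipTail-commutes-at-follower (flipTail-commutes-at-follower comm₀ (link refl refl)) (link refl refl)
        step : ∀ b → CommutesAt b → CommutesAt (next b)
        step b at-b s t = flipTail-commutes-at-follower (at-b false s) (link refl refl)

    preserving-from-one : ∀ {x₀} → F (flipTail x₀) ≡ flipTail (F x₀) → Preserving F
    preserving-from-one comm₀ = commT , commH
      where
        commT : Intertwines F flipTail flipTail
        commT = flipTail-commutes-everywhere comm₀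
        commH : Intertwines F flipHead flipHead
        commH x with mono-twin mono (inj₂ (refl {x = flipHead x}))
        ... | inj₁ e = ⊥-elim (flips-not-merged x (trans (commT x) (sym e)))
        ... | inj₂ e = e

  rotFlip : ℕ → (Z → Bool) → Arc → Arc
  rotFlip c w (arc b s t) = arc (shift c b) (s xor w b) (t xor w (next b))

  rotFlip-preserving : ∀ c w → Preserving (rotFlip c w)
  rotFlip-preserving c w = (λ { (arc b s t) → cong (λ s' → arc (shift c b) s' (t xor w (next b))) (sym (not-distribˡ-xor s (w b))) })
                         , (λ { (arc b s t) → cong (arc (shift c b) (s xor w b)) (sym (not-distribˡ-xor t (w (next b)))) })

  flips : (Z → Bool) → Arc → Arc
  flips w (arc b s t) = arc b (s xor w b) (t xor w (next b))

  rotFlip-≈0 : ∀ {c} w → c ≈ 0 → ∀ x → rotFlip c w x ≡ flips w x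
  rotFlip-≈0 w c≈0 (arc b s t) = cong (λ b' → arc b' (s xor w b) (t xor w (next b))) (trans (shift-cong b c≈0) (shift-0 b))

  flips-preserving : ∀ w → Preserving (flips w)
  flips-preserving w = intertwines-ext {rotFlip 0 w} {flips w} {flipTail} {flipTail} (rotFlip-≈0 w ≈-refl) (proj₁ (rotFlip-preserving 0 w))
                     , intertwines-ext {rotFlip 0 w} {flips w} {flipHead} {flipHead} (rotFlip-≈0 w ≈-refl) (proj₂ (rotFlip-preserving 0 w))

  RotFlip : (Arc → Arc) → Set
  RotFlip F = ∃[ c ] ∃[ w ] (∀ x → F x ≡ rotFlip c w x)

  preserving⇒rotFlip : ∀ {F} → Mono F → Preserving F → RotFlip F
  preserving⇒rotFlip {F} mono (commT , commH) =
    c , w , λ { (arc b s t) → arc-≡ (trans (proj₁ (base-tail b s t)) (σ≡shift b)) (proj₂ (base-tail b s t)) (head-F b s t) }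
    where
      σ : Z → Z
      σ b = base (F (arc b false false))
      w : Z → Bool
      w b = tail (F (arc b false false))
      c : ℕ
      c = toℕ (σ zero)
      base-tail₀ : ∀ b t → base (F (arc b false t)) ≡ σ b × tail (F (arc b false t)) ≡ w b
      base-tail₀ b false = refl , refl
      base-tail₀ b true  = cong base (commH (arc b false false)) , cong tail (commH (arc b false false))
      base-tail : ∀ b s t → base (F (arc b s t)) ≡ σ b × tail (F (arc b s t)) ≡ s xor w b
      base-tail b false t = base-tail₀ b t
      base-tail b true  t = trans (cong base (commT (arc b false t))) (proj₁ (base-tail₀ b t))
                          , trans (cong tail (commT (arc b false t))) (cong not (proj₂ (base-tail₀ b t)))
      head-F : ∀ b s t → head (F (arc b s t)) ≡ t xor w (next b)
      head-F b s t = trans (_⇝_.head≡tail (mono-⇝ mono (commT _) (link refl refl))) (proj₂ (base-tail (next b) t false))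
      σ-next : ∀ b → σ (next b) ≡ next (σ b)
      σ-next b = sym (_⇝_.next-base (mono-⇝ mono (commT _) (link refl refl)))
      σ≡shift : ∀ b → σ b ≡ shift c b
      σ≡shift = next-induction (λ b → σ b ≡ shift c b) zero (sym ([]-toℕ (σ zero)))
        (λ b e → trans (σ-next b) (trans (cong next e) (shift-comm 1 c b)))

  reverse : Arc → Arc
  reverse (arc b s t) = arc (mirror b) t s

  reverse-involutive : ∀ x → reverse (reverse x) ≡ x
  reverse-involutive (arc b s t) = cong (λ b → arc b s t) (mirror-involutive b)

  reverse-⇝ : ∀ {x y} → x ⇝ y → reverse y ⇝ reverse x
  reverse-⇝ {arc b s t} {arc b' s' t'} (link refl t≡s') = link (next-mirror-next b) (sym t≡s')

  reverse-mono : Mono reverse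
  reverse-mono = (λ {x} {y} e → trans (sym (reverse-involutive x)) (trans (cong reverse e) (reverse-involutive y)))
               , λ { (inj₁ x⇝y) → inj₂ (reverse-⇝ x⇝y) ; (inj₂ y⇝x) → inj₁ (reverse-⇝ y⇝x) }

  RotFlipReverse : (Arc → Arc) → Set
  RotFlipReverse F = ∃[ c ] ∃[ w ] (∀ x → F x ≡ rotFlip c w (reverse x))

  rotFlip∘reverse-reversing : ∀ {F c w} → (∀ x → F x ≡ rotFlip c w (reverse x)) → Reversing F
  rotFlip∘reverse-reversing {F} {c} {w} F≗ =
    intertwines-ext {rotFlip c w ∘ reverse} {F} {flipTail} {flipHead} (sym ∘ F≗) (λ x → proj₂ (rotFlip-preserving c w) (reverse x)) ,
    intertwines-ext {rotFlip c w ∘ reverse} {F} {flipHead} {flipTail} (sym ∘ F≗) (λ x → proj₁ (rotFlip-preserving c w) (reverse x))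

  rotFlip-after-reverse : ∀ {F} → RotFlip (F ∘ reverse) → RotFlipReverse F
  rotFlip-after-reverse {F} (c , w , F∘reverse≗) =
    c , w , λ x → trans (cong F (sym (reverse-involutive x))) (F∘reverse≗ (reverse x))

  mono-classification : ∀ {F} → Mono F → RotFlip F ⊎ RotFlipReverse F
  mono-classification {F} mono with mono-twin mono (inj₁ (refl {x = flipTail (reverse origin)}))
  ... | inj₁ comm = inj₁ (preserving⇒rotFlip mono (preserving-from-one mono comm))
  ... | inj₂ comm' with mono-twin mono (inj₂ (refl {x = flipHead (reverse origin)}))
  ...   | inj₁ comm = inj₂ (rotFlip-after-reverse (preserving⇒rotFlip mono∘reverse (preserving-from-one mono∘reverse comm)))
    where mono∘reverse : Mono (F ∘ reverse)
          mono∘reverse = mono-∘ reverse-mono mono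
  ...   | inj₂ comm = ⊥-elim (flips-not-merged mono (reverse origin) (trans comm' (sym comm)))

  periodic-flips-flip-everything : ∀ {w e} → Periodic w e → Unit e → flips w origin ≢ origin → ∀ b → w b ≡ true
  periodic-flips-flip-everything {w} {e} per e-unit moves b = trans (constant b) w₀≡true
    where
      constant : ∀ b → w b ≡ w zero
      constant = periodic-1⇒constant {w} (periodic-unit {w} {e} per e-unit)
      w₀≡true : w zero ≡ true
      w₀≡true = ¬-not λ w₀≡false → moves (arc-≡ refl w₀≡false (trans (constant (next zero)) w₀≡false))

  encode : Bool → Bool → Fin 4
  encode false false = zero
  encode false true  = suc zero
  encode true  false = suc (suc zero)
  encode true  true  = suc (suc (suc zero))

  decode : Fin 4 → Bool × Bool
  decode zero                = false , false
  decode (suc zero)          = false , true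
  decode (suc (suc zero))    = true  , false
  decode (suc (suc (suc _))) = true  , true

  decode-encode : ∀ s t → decode (encode s t) ≡ (s , t)
  decode-encode false false = refl
  decode-encode false true  = refl
  decode-encode true  false = refl
  decode-encode true  true  = refl

  encode-injective : ∀ {s t s' t'} → encode s t ≡ encode s' t' → (s , t) ≡ (s' , t')
  encode-injective {s} {t} {s'} {t'} e = trans (sym (decode-encode s t)) (trans (cong decode e) (decode-encode s' t'))

  module NoRegularGroup (odd-m : odd m ≡ true) (3∤m : ¬ 3 ∣ m) (G : RegularGroup) where
    open RegularGroup G
    open OddModulus odd-m

    member-classification : ∀ {f} → Member f → RotFlip f ⊎ RotFlipReverse f
    member-classification f∈G = mono-classification (member-mono f∈G)

    conjugate-flips : ∀ {c v w} → Member (rotFlip c v) → Member (flips w) →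
                      ∃[ w' ] Member (flips w') × (∀ b → w' (shift c b) ≡ w b)
    conjugate-flips {c} {v} {w} g∈G k∈G with g⁻¹ , g⁻¹∈G , left , right ← member-inverse g∈G
      with c' , w' , conj≗ ← preserving⇒rotFlip (member-mono (member-∘ (member-∘ g⁻¹∈G k∈G) g∈G))
                               (conjugate-preserving {rotFlip c v} {g⁻¹} {flips w} (rotFlip-preserving c v) (flips-preserving w) left right) =
      w' , member-ext (member-∘ (member-∘ g⁻¹∈G k∈G) g∈G) (λ x → trans (conj≗ x) (rotFlip-≈0 w' c'≈0 x)) , bits
      where
        through : ∀ b → rotFlip c' w' (rotFlip c v (arc b false false)) ≡ rotFlip c v (flips w (arc b false false))
        through b = trans (sym (conj≗ (rotFlip c v y))) (cong (rotFlip c v ∘ flips w) (left y))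
          where y : Arc
                y = arc b false false
        c'≈0 : c' ≈ 0
        c'≈0 = shift-≈ (shift c zero) (trans (cong base (through zero)) (sym (shift-0 _)))
        bits : ∀ b → w' (shift c b) ≡ w b
        bits b = xor-cancelˡ (v b) (trans (cong tail (through b)) (xor-comm (w b) (v b)))

    conjugates : ∀ {c v w} → Member (rotFlip c v) → Member (flips w) →
                 ∀ n → ∃[ wₙ ] Member (flips wₙ) × (∀ b → wₙ (shift (n * c) b) ≡ w b)
    conjugates {w = w} g∈G k∈G zero = w , k∈G , λ b → cong w (shift-0 b)
    conjugates {c} g∈G k∈G (suc n) with wₙ , kₙ∈G , wₙ-shift ← conjugates g∈G k∈G n
      with w' , k'∈G , w'-shift ← conjugate-flips g∈G kₙ∈G =
      w' , k'∈G , λ b → trans (cong w' (shift-split b)) (trans (w'-shift _) (wₙ-shift b))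
      where
        shift-split : ∀ b → shift (suc n * c) b ≡ shift c (shift (n * c) b)
        shift-split b = trans (cong (λ d → shift d b) (+-comm c (n * c))) (sym (shift-shift c (n * c) b))

    flips-determined-at-origin : ∀ {w w'} → Member (flips w) → Member (flips w') →
                                 flips w origin ≡ flips w' origin → ∀ b → w b ≡ w' b
    flips-determined-at-origin {w} {w'} k∈G k'∈G e b =
      cong tail (semiregular origin k∈G k'∈G e (arc b false false))

    -- Two of the first five conjugates agree at the origin, hence everywhere.
    period-of-conjugates : ∀ {c w} (wₙ : ℕ → Z → Bool) → (∀ n → Member (flips (wₙ n))) →
                           (∀ n b → wₙ n (shift (n * c) b) ≡ w b) → ∃[ d ] 1 ≤ d × d ≤ 4 × Periodic w (d * c)
    period-of-conjugates {c} {w} wₙ member shifted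
      with i , j , i<j , same ← Fin.pigeonhole (n<1+n 4) (λ i → encode (wₙ (toℕ i) zero) (wₙ (toℕ i) (next zero)))
      with o , i+1+o≡j ← m≤n⇒∃[o]m+o≡n i<j =
      suc o , s≤s z≤n , ≤-trans (m≤n+m (suc o) (toℕ i)) (≤-trans (≤-reflexive i+d≡j) (≤-pred (Fin.toℕ<n j))) ,
      repeat⇒periodic {c} {w} {wₙ (toℕ i)} {wₙ (toℕ j)} (toℕ i) (suc o) (shifted (toℕ i))
        (λ b → trans (cong (λ n → wₙ (toℕ j) (shift (n * c) b)) i+d≡j) (shifted (toℕ j) b))
        (flips-determined-at-origin {wₙ (toℕ i)} {wₙ (toℕ j)} (member (toℕ i)) (member (toℕ j))
          (cong (λ p → arc zero (proj₁ p) (proj₂ p)) (encode-injective same)))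
      where
        i+d≡j : toℕ i + suc o ≡ toℕ j
        i+d≡j = trans (+-suc (toℕ i) o) i+1+o≡j

    flips-period : ∀ {c v w} → Member (rotFlip c v) → Member (flips w) → ∃[ d ] 1 ≤ d × d ≤ 4 × Periodic w (d * c)
    flips-period g∈G k∈G = period-of-conjugates (λ n → proj₁ (conjugates g∈G k∈G n))
                             (λ n → proj₁ (proj₂ (conjugates g∈G k∈G n))) (λ n → proj₂ (proj₂ (conjugates g∈G k∈G n)))

    nontrivial-flips-flip-everything : ∀ {c v w} → Member (rotFlip c v) → Unit c → Member (flips w) →
                                       flips w origin ≢ origin → ∀ b → w b ≡ true
    nontrivial-flips-flip-everything {c} {v} {w} g∈G c-unit k∈G =
      periodic-flips-flip-everything {w} per (*-unit {d} {c} (unit-≤4 (unit-3 3∤m) d 1≤d d≤4) c-unit)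
      where
        period : ∃[ d ] 1 ≤ d × d ≤ 4 × Periodic w (d * c)
        period = flips-period {c} {v} {w} g∈G k∈G
        d : ℕ
        d = proj₁ period
        1≤d : 1 ≤ d
        1≤d = proj₁ (proj₂ period)
        d≤4 : d ≤ 4
        d≤4 = proj₁ (proj₂ (proj₂ period))
        per : Periodic w (d * c)
        per = proj₂ (proj₂ (proj₂ period))

    UnitRotation : Set
    UnitRotation = ∃[ c ] ∃[ v ] Member (rotFlip c v) × Unit c

    unit-rotation-from : ∀ {f c v e} → Member f → (∀ x → f x ≡ rotFlip c v x) →
                         base (f origin) ≡ shift e zero → Unit e → UnitRotation
    unit-rotation-from {f} {c} {v} {e} f∈G f≗ base≡ e-unit =
      c , v , member-ext f∈G f≗ , ≈-unit {c} {e} (shift-≈ {c} {e} zero (trans (cong base (sym (f≗ origin))) base≡)) e-unit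

    -- The composite f₂ ∘ f₁ preserves the flips and rotates by one.
    unit-rotation-from-reversing : ∀ {f₁ f₂ c₁ v₁ c₂ v₂} → Member f₁ → Member f₂ →
      (∀ x → f₁ x ≡ rotFlip c₁ v₁ (reverse x)) → (∀ x → f₂ x ≡ rotFlip c₂ v₂ (reverse x)) →
      f₁ origin ≡ arc (next zero) false false → base (f₂ origin) ≡ next (next zero) → UnitRotation
    unit-rotation-from-reversing {f₁} {f₂} {c₁} {v₁} {c₂} {v₂} f₁∈G f₂∈G f₁≗ f₂≗ f₁-origin f₂-origin =
      unit-rotation-from {f₂ ∘ f₁} {proj₁ form} {proj₁ (proj₂ form)} {1}
        (member-∘ f₁∈G f₂∈G) (proj₂ (proj₂ form)) base≡ (1 , ≈-refl)
      where
        form : RotFlip (f₂ ∘ f₁)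
        form = preserving⇒rotFlip {f₂ ∘ f₁} (member-mono (member-∘ f₁∈G f₂∈G))
                 (reversing-∘ {f₁} {f₂} (rotFlip∘reverse-reversing {f₁} {c₁} {v₁} f₁≗)
                                        (rotFlip∘reverse-reversing {f₂} {c₂} {v₂} f₂≗))
        base≡ : base (f₂ (f₁ origin)) ≡ shift 1 zero
        base≡ = begin
          base (f₂ (f₁ origin))                  ≡⟨ cong (base ∘ f₂) f₁-origin ⟩
          base (f₂ (arc (next zero) false false)) ≡⟨ cong base (f₂≗ (arc (next zero) false false)) ⟩
          shift c₂ (mirror (next zero))          ≡⟨ next-injective (begin
              next (shift c₂ (mirror (next zero)))   ≡⟨ shift-comm 1 c₂ (mirror (next zero)) ⟩
              shift c₂ (next (mirror (next zero)))   ≡⟨ cong (shift c₂) (next-mirror-next zero) ⟩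
              shift c₂ (mirror zero)                 ≡⟨ cong base (f₂≗ origin) ⟨
              base (f₂ origin)                       ≡⟨ f₂-origin ⟩
              next (next zero)                       ∎) ⟩
          next zero                              ∎
          where open ≡-Reasoning

    unit-rotation : UnitRotation
    unit-rotation with f₁ , f₁∈G , f₁-origin ← transitive (arc (next zero) false false)
                  with member-classification f₁∈G
    ... | inj₁ (c₁ , v₁ , f₁≗) = unit-rotation-from {f₁} {c₁} {v₁} {1} f₁∈G f₁≗ (cong base f₁-origin) (1 , ≈-refl)
    ... | inj₂ (c₁ , v₁ , f₁≗) with f₂ , f₂∈G , f₂-origin ← transitive (arc (next (next zero)) false false)
                               with member-classification f₂∈G
    ...   | inj₁ (c₂ , v₂ , f₂≗) =
      unit-rotation-from {f₂} {c₂} {v₂} {2} f₂∈G f₂≗ (trans (cong base f₂-origin) (shift-shift 1 1 zero)) unit-2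
    ...   | inj₂ (c₂ , v₂ , f₂≗) =
      unit-rotation-from-reversing {f₁} {f₂} {c₁} {v₁} {c₂} {v₂} f₁∈G f₂∈G f₁≗ f₂≗ f₁-origin (cong base f₂-origin)

    flips-everything : ∀ {f c w} → Member f → (∀ x → f x ≡ rotFlip c w x) → f origin ≢ origin → c ≈ 0 →
                       ∀ b → w b ≡ true
    flips-everything {f} {c} {w} f∈G f≗ moves c≈0 =
      nontrivial-flips-flip-everything {proj₁ unit-rotation} {proj₁ (proj₂ unit-rotation)} {w}
        (proj₁ (proj₂ (proj₂ unit-rotation))) (proj₂ (proj₂ (proj₂ unit-rotation)))
        (member-ext f∈G f≗flips) (λ e → moves (trans (f≗flips origin) e))
      where
        f≗flips : ∀ x → f x ≡ flips w x
        f≗flips x = trans (f≗ x) (rotFlip-≈0 w c≈0 x)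

    base-fixed⇒≈0 : ∀ {c w} → base (rotFlip c w origin) ≡ zero → c ≈ 0
    base-fixed⇒≈0 {c} base≡ = shift-≈ {c} {0} zero (trans base≡ (sym (shift-0 zero)))

    no-preserving-tail-flip : ∀ {f c v} → Member f → (∀ x → f x ≡ rotFlip c v x) → f origin ≡ flipTail origin → ⊥
    no-preserving-tail-flip {f} {c} {v} f∈G f≗ f-origin =
      true≢false (trans (sym (flips-everything {f} {c} {v} f∈G f≗ moves (base-fixed⇒≈0 {c} {v} (cong base f-origin′)) (next zero)))
                    (cong head f-origin′))
      where
        f-origin′ : rotFlip c v origin ≡ flipTail origin
        f-origin′ = trans (sym (f≗ origin)) f-origin
        moves : f origin ≢ origin
        moves e = flipTail-≢ origin (trans (sym e) f-origin)

    -- f₀ ∘ f₀ must flip every colour, but its tail flip at an arc combines two values of v at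
    -- bases exchanged by b ↦ −1 − b, which cancel at the fixed point h of that map.
    no-reversing-tail-flip : ∀ {f₀ c₀ v} → Member f₀ → (∀ x → f₀ x ≡ rotFlip c₀ v (reverse x)) →
                             f₀ origin ≡ flipTail origin → ⊥
    no-reversing-tail-flip {f₀} {c₀} {v} f₀∈G f₀≗ f₀-origin =
      true≢false (trans (sym (flips-everything {f₀ ∘ f₀} {c} {w} (member-∘ f₀∈G f₀∈G) f₀²≗ moves c≈0 x))
                    (trans (sym (cong tail (f₀²≗ (arc x false false)))) flips-cancel))
      where
        reversing : Reversing f₀
        reversing = rotFlip∘reverse-reversing {f₀} {c₀} {v} f₀≗
        square : RotFlip (f₀ ∘ f₀)
        square = preserving⇒rotFlip {f₀ ∘ f₀} (member-mono (member-∘ f₀∈G f₀∈G))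
                   (reversing-∘ {f₀} {f₀} reversing reversing)
        c : ℕ
        c = proj₁ square
        w : Z → Bool
        w = proj₁ (proj₂ square)
        f₀²≗ : ∀ x → f₀ (f₀ x) ≡ rotFlip c w x
        f₀²≗ = proj₂ (proj₂ square)
        x : Z
        x = mirror (prev [ h ])
        f₀-origin′ : rotFlip c₀ v (reverse origin) ≡ flipTail origin
        f₀-origin′ = trans (sym (f₀≗ origin)) f₀-origin
        f₀²-origin : f₀ (f₀ origin) ≡ arc zero true true
        f₀²-origin = trans (cong f₀ f₀-origin) (trans (f₀≗ (flipTail origin))
                       (arc-≡ (cong base f₀-origin′) (cong tail f₀-origin′) (cong not (cong head f₀-origin′))))
        moves : f₀ (f₀ origin) ≢ origin
        moves e = true≢false (cong tail (trans (sym f₀²-origin) e))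
        c≈0 : c ≈ 0
        c≈0 = base-fixed⇒≈0 {c} {w} (trans (cong base (sym (f₀²≗ origin))) (cong base f₀²-origin))
        c₀≈1 : c₀ ≈ 1
        c₀≈1 = shift-≈ {c₀} {1} (mirror zero) (trans (cong base f₀-origin′) (sym next-mirror-zero))
        next-mirror-x : next (mirror x) ≡ [ h ]
        next-mirror-x = trans (cong next (mirror-involutive (prev [ h ]))) (next-prev [ h ])
        mirror-image : mirror (shift c₀ (mirror x)) ≡ [ h ]
        mirror-image = trans (cong mirror (trans (shift-cong (mirror x) c₀≈1) next-mirror-x)) mirror-fixed
        y : Arc
        y = arc x false false
        flips-cancel : tail (f₀ (f₀ y)) ≡ false
        flips-cancel = begin
          tail (f₀ (f₀ y))                                            ≡⟨ cong tail (trans (cong f₀ (f₀≗ y)) (f₀≗ (rotFlip c₀ v (reverse y)))) ⟩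
          v (next (mirror x)) xor v (mirror (shift c₀ (mirror x)))   ≡⟨ cong₂ (λ a b → v a xor v b) next-mirror-x mirror-image ⟩
          v [ h ] xor v [ h ]                                         ≡⟨ xor-same (v [ h ]) ⟩
          false                                                       ∎
          where open ≡-Reasoning

    impossible : ⊥
    impossible with f₀ , f₀∈G , f₀-origin ← transitive (flipTail origin)
               with member-classification f₀∈G
    ... | inj₁ (c , v , f₀≗) = no-preserving-tail-flip {f₀} {c} {v} f₀∈G f₀≗ f₀-origin
    ... | inj₂ (c , v , f₀≗) = no-reversing-tail-flip {f₀} {c} {v} f₀∈G f₀≗ f₀-origin

module RoseWindowArcs (a : ℕ) (odd-m : odd (suc (suc a)) ≡ true) where

  k : ℕ
  k = suc a

  open Modular k
  open OddModulus odd-m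
  open ArcGraph k

  n : ℕ
  n = 2 * m

  -- Through ℤ₂ₘ ≅ ℤₘ × ℤ₂ (m odd), A_i and B_i become arcs over the bases i − 1 and i − 2
  -- (k ≡ −1 mod m) whose end colours are read off the parity of i.
  embed : Side → ℕ → Arc
  embed A i = arc [ i + k ] (not (odd i)) (odd i)
  embed B i = arc [ i + k + k ] (not (odd i)) (not (odd i))

  φ : RWVertex n → Arc
  φ (s , i) = embed s (toℕ i)

  not-flip : ∀ {x y} → x ≡ not y → y ≡ not x
  not-flip {x} {y} e = trans (sym (not-involutive y)) (cong not (sym e))

  odd-a : odd a ≡ true
  odd-a = trans (sym (not-involutive (odd a))) odd-m

  odd-+1 : ∀ i → odd (i + 1) ≡ not (odd i)
  odd-+1 i = trans (odd-+ i 1) (trans (xor-comm (odd i) true) (true-xor (odd i)))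

  odd-+a : ∀ i → odd (i + a) ≡ not (odd i)
  odd-+a i = trans (odd-+ i a) (trans (cong (odd i xor_) odd-a) (trans (xor-comm (odd i) true) (true-xor (odd i))))

  odd-+k : ∀ i → odd (i + k) ≡ odd i
  odd-+k i = trans (odd-+ i k) (trans (cong (odd i xor_) (cong not odd-a)) (xor-identityʳ (odd i)))

  next-[]⇔ : ∀ {u v} → (next [ u ] ≡ [ v ]) ⇔ (u + 1 ≈ v)
  next-[]⇔ {u} = mk⇔ (λ e → ≈-trans (≈-sym (+-cong-≈ (toℕ-[]-≈ u) (≈-refl {1}))) ([]-injective e))
                     (λ e → []-cong (≈-trans (+-cong-≈ (toℕ-[]-≈ u) (≈-refl {1})) e))

  open Equivalence using (to; from)

  A⇝A : ∀ i j → (j ≡ i + 1 [mod n ]) ⇔ (embed A i ⇝ embed A j)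
  A⇝A i j = mk⇔
    (λ p → let j≈i+1 , parity = ≡[mod2m]⇒ p in
      link (from next-[]⇔ (≈-trans (≡⇒≈ (shuffle i k)) (+-cong-≈ (≈-sym j≈i+1) (≈-refl {k}))))
           (not-flip (trans parity (odd-+1 i))))
    (λ { (link e o) → ≡[mod2m]⇐ (≈-sym (+-cancelʳ-≈ k (≈-trans (≡⇒≈ (sym (shuffle i k))) (to next-[]⇔ e))))
                                (trans (not-flip o) (sym (odd-+1 i))) })
    where shuffle : ∀ i k → i + k + 1 ≡ i + 1 + k
          shuffle = solve-∀

  A⇝B : ∀ i j → (i ≡ j + a [mod n ]) ⇔ (embed A i ⇝ embed B j)
  A⇝B i j = mk⇔
    (λ p → let i≈j+a , parity = ≡[mod2m]⇒ p in
      link (from next-[]⇔ (≈-trans (≡⇒≈ (assoc i k)) (≈-trans (+-cong-≈ i≈j+a (≈-refl {k + 1})) (≡⇒≈ (sym (shuffle j a))))))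
           (trans parity (odd-+a j)))
    (λ { (link e o) → ≡[mod2m]⇐
           (+-cancelʳ-≈ (k + 1) (≈-trans (≡⇒≈ (sym (assoc i k))) (≈-trans (to next-[]⇔ e) (≡⇒≈ (shuffle j a)))))
                                (trans o (sym (odd-+a j))) })
    where assoc : ∀ i k → i + k + 1 ≡ i + (k + 1)
          assoc = solve-∀
          shuffle : ∀ j a → j + suc a + suc a ≡ j + a + (suc a + 1)
          shuffle = solve-∀

  B⇝A : ∀ i j → (i ≡ j [mod n ]) ⇔ (embed B j ⇝ embed A i)
  B⇝A i j = mk⇔
    (λ p → let i≈j , parity = ≡[mod2m]⇒ p in
      link (from next-[]⇔ (≈-trans (≈-by 0 1 (wrap j k)) (+-cong-≈ (≈-sym i≈j) (≈-refl {k})))) (cong not (sym parity)))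
    (λ { (link e o) → ≡[mod2m]⇐ (≈-sym (+-cancelʳ-≈ k (≈-trans (≈-sym (≈-by 0 1 (wrap j k))) (to next-[]⇔ e))))
                                (sym (not-injective o)) })
    where wrap : ∀ j k → j + k + k + 1 + 0 * suc k ≡ j + k + 1 * suc k
          wrap = solve-∀

  B⇝B : ∀ i j → (j ≡ i + k [mod n ]) ⇔ (embed B j ⇝ embed B i)
  B⇝B i j = mk⇔
    (λ p → let j≈i+k , parity = ≡[mod2m]⇒ p in
      link (from next-[]⇔ (≈-trans (≡⇒≈ (shuffle j k))
             (+-cong-≈ (+-cong-≈ (≈-trans (+-cong-≈ j≈i+k (≈-refl {1})) (≈-by 0 1 (wrap i k))) (≈-refl {k})) (≈-refl {k}))))
           (cong not (trans parity (odd-+k i))))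
    (λ { (link e o) → ≡[mod2m]⇐
           (+-cancelʳ-≈ 1 (≈-trans (+-cancelʳ-≈ k (+-cancelʳ-≈ k (≈-trans (≡⇒≈ (sym (shuffle j k))) (to next-[]⇔ e))))
                                   (≈-sym (≈-by 0 1 (wrap i k)))))
           (trans (not-injective o) (sym (odd-+k i))) })
    where shuffle : ∀ j k → j + k + k + 1 ≡ j + 1 + k + k
          shuffle = solve-∀
          wrap : ∀ i k → i + k + 1 + 0 * suc k ≡ i + 1 * suc k
          wrap = solve-∀

  swapped : ∀ {P Q R S : Set} → (P ⊎ Q) ⇔ (R ⊎ S) → (P ⊎ Q) ⇔ (S ⊎ R)
  swapped e = mk⇔ (swap ∘ to e) (from e ∘ swap)

  adjacent⇔ : ∀ u v → RWAdj n a k u v ⇔ Adjacent (φ u) (φ v)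
  adjacent⇔ (A , i) (A , j) = A⇝A (toℕ i) (toℕ j) ⊎-⇔ A⇝A (toℕ j) (toℕ i)
  adjacent⇔ (A , i) (B , j) = swapped (B⇝A (toℕ i) (toℕ j) ⊎-⇔ A⇝B (toℕ i) (toℕ j))
  adjacent⇔ (B , i) (A , j) = B⇝A (toℕ j) (toℕ i) ⊎-⇔ A⇝B (toℕ j) (toℕ i)
  adjacent⇔ (B , i) (B , j) = swapped (B⇝B (toℕ i) (toℕ j) ⊎-⇔ B⇝B (toℕ j) (toℕ i))

  n≡m+m : n ≡ m + m
  n≡m+m = cong (m +_) (+-identityʳ m)

  lift : (x : ℕ) (p : Bool) → ∃[ i ] toℕ {n} i ≈ x × odd (toℕ i) ≡ p
  lift x p with odd (x % m) ≟ᵇ p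
  ... | yes same = fromℕ< r<n , subst (_≈ x) (sym (Fin.toℕ-fromℕ< r<n)) (mk≈ (m%n%n≡m%n x m)) ,
                   trans (cong odd (Fin.toℕ-fromℕ< r<n)) same
    where r<n : x % m < n
          r<n = ≤-trans (m%n<n x m) (subst (m ≤_) (sym n≡m+m) (m≤m+n m m))
  ... | no differ = fromℕ< r+m<n ,
                    subst (_≈ x) (sym (Fin.toℕ-fromℕ< r+m<n)) (≈-trans (≈-by 0 1 (wrap (x % m) m)) (mk≈ (m%n%n≡m%n x m))) ,
                    trans (cong odd (Fin.toℕ-fromℕ< r+m<n))
                      (trans (odd-+ (x % m) m) (trans (cong (odd (x % m) xor_) odd-m)
                        (trans (xor-comm (odd (x % m)) true) (trans (true-xor (odd (x % m))) (sym (¬-not (differ ∘ sym)))))))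
    where r+m<n : x % m + m < n
          r+m<n = subst (x % m + m <_) (sym n≡m+m) (+-monoˡ-< m (m%n<n x m))
          wrap : ∀ r m → r + m + 0 * m ≡ r + 1 * m
          wrap = solve-∀

  ψ : Arc → RWVertex n
  ψ (arc b false true)  = A , proj₁ (lift (toℕ b + 1) true)
  ψ (arc b true  false) = A , proj₁ (lift (toℕ b + 1) false)
  ψ (arc b false false) = B , proj₁ (lift (toℕ b + 2) true)
  ψ (arc b true  true)  = B , proj₁ (lift (toℕ b + 2) false)

  base-A : ∀ i b → i ≈ toℕ b + 1 → [ i + k ] ≡ b
  base-A i b i≈b+1 = trans ([]-cong (≈-trans (+-cong-≈ i≈b+1 (≈-refl {k})) (≈-by 0 1 (wrap (toℕ b) k)))) ([]-toℕ b)
    where wrap : ∀ b k → b + 1 + k + 0 * suc k ≡ b + 1 * suc k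
          wrap = solve-∀

  base-B : ∀ i b → i ≈ toℕ b + 2 → [ i + k + k ] ≡ b
  base-B i b i≈b+2 =
    trans ([]-cong (≈-trans (+-cong-≈ (+-cong-≈ i≈b+2 (≈-refl {k})) (≈-refl {k})) (≈-by 0 2 (wrap (toℕ b) k)))) ([]-toℕ b)
    where wrap : ∀ b k → b + 2 + k + k + 0 * suc k ≡ b + 2 * suc k
          wrap = solve-∀

  φψ : ∀ x → φ (ψ x) ≡ x
  φψ (arc b false true)  with i , i≈ , parity ← lift (toℕ b + 1) true  = arc-≡ (base-A (toℕ i) b i≈) (cong not parity) parity
  φψ (arc b true  false) with i , i≈ , parity ← lift (toℕ b + 1) false = arc-≡ (base-A (toℕ i) b i≈) (cong not parity) parity
  φψ (arc b false false) with i , i≈ , parity ← lift (toℕ b + 2) true  =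
    arc-≡ (base-B (toℕ i) b i≈) (cong not parity) (cong not parity)
  φψ (arc b true  true)  with i , i≈ , parity ← lift (toℕ b + 2) false =
    arc-≡ (base-B (toℕ i) b i≈) (cong not parity) (cong not parity)

  n≤+[1+q]n : ∀ x q → n ≤ x + suc q * n
  n≤+[1+q]n x q = ≤-trans (m≤m+n n (q * n)) (m≤n+m (n + q * n) x)

  mod-unique : ∀ {x y} → x < n → y < n → x ≡ y [mod n ] → x ≡ y
  mod-unique {x} {y} _   _   (inj₁ (zero , e))  = trans (sym (+-identityʳ x)) e
  mod-unique {x} {y} _   y<n (inj₁ (suc q , e)) = ⊥-elim (<⇒≱ y<n (subst (n ≤_) e (n≤+[1+q]n x q)))
  mod-unique {x} {y} _   _   (inj₂ (zero , e))  = sym (trans (sym (+-identityʳ y)) e)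
  mod-unique {x} {y} x<n _   (inj₂ (suc q , e)) = ⊥-elim (<⇒≱ x<n (subst (n ≤_) e (n≤+[1+q]n y q)))

  Fin-≡ : ∀ (i j : Fin n) → toℕ i ≈ toℕ j → odd (toℕ i) ≡ odd (toℕ j) → i ≡ j
  Fin-≡ i j i≈j parity = Fin.toℕ-injective (mod-unique (Fin.toℕ<n i) (Fin.toℕ<n j) (≡[mod2m]⇐ i≈j parity))

  φ-injective : ∀ {u v} → φ u ≡ φ v → u ≡ v
  φ-injective {A , i} {A , j} e = cong (A ,_) (Fin-≡ i j (+-cancelʳ-≈ k ([]-injective (cong base e))) (cong head e))
  φ-injective {B , i} {B , j} e =
    cong (B ,_) (Fin-≡ i j (+-cancelʳ-≈ k (+-cancelʳ-≈ k ([]-injective (cong base e)))) (not-injective (cong head e)))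
  φ-injective {A , i} {B , j} e = ⊥-elim (not-¬ refl (trans (cong head e) (sym (cong tail e))))
  φ-injective {B , i} {A , j} e = ⊥-elim (not-¬ refl (trans (cong head (sym e)) (sym (cong tail (sym e)))))

  ψφ : ∀ u → ψ (φ u) ≡ u
  ψφ u = φ-injective (φψ (φ u))

4≉0 : ∀ j → odd (3 + j) ≡ true → ¬ Modular._≈_ (2 + j) 4 0
4≉0 zero          _ (Modular.mk≈ ())
4≉0 (suc zero)    ()
4≉0 (suc (suc j)) _ (Modular.mk≈ 4%m≡0) = 1+n≢0 (trans (sym (m<n⇒m%n≡m 4<m)) 4%m≡0)
  where 4<m : 4 < 5 + j
        4<m = s≤s (s≤s (s≤s (s≤s (s≤s z≤n))))

mainTheorem10 : (m : ℕ) → 3 ≤ m → ¬ (2 ∣ m) → ¬ (3 ∣ m) →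
    ¬ RoseWindowCayley (2 * m) (m ∸ 2) (m ∸ 1)
mainTheorem10 (suc (suc (suc j))) (s≤s (s≤s (s≤s _))) 2∤m 3∤m cayley =
  NoRegularGroup.impossible odd-m 3∤m (cayley⇒regularGroup φψ ψφ adjacent⇔ cayley)
  where
    odd-m : odd (3 + j) ≡ true
    odd-m = 2∤⇒odd (3 + j) 2∤m
    open ArcGraph (2 + j) using (cayley⇒regularGroup)
    open ArcAutomorphisms (2 + j) (4≉0 j odd-m) using (module NoRegularGroup)
    open RoseWindowArcs (1 + j) odd-m using (φψ; ψφ; adjacent⇔)
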